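{- Let $n \geq 1$ and consider real numbers $r_1,\dots,r_n,c_1,\dots,c_n,d_1,\dots,d_n$ defined as follows. If $n = 3t+1$ with $t\geq 0$ an integer, set $r_i = c_i = \max\{0, \frac{i-t-1}{3t+1}\}$ and $d_i = \max\{0,\frac{i-t}{3t+1}\}$ for $1\le i\le n$. If $n = 3t+2$ with $t \geq 0$, set $r_i = c_i = d_i = \max\{0,\frac{i-t-1}{3t+2}\}$. If $n = 3t$ with $t \geq 1$, set $r_i = c_i = d_i = \max\{0,\frac{i-t}{3t+1}\}$. Then these values form a feasible solution of the linear program $$\text{minimize } \sum_{i=1}^n r_i + \sum_{j=1}^n c_j + \sum_{k=1}^n d_k \quad\text{subject to}\quad r_i + c_j + d_k \geq 1 \text{ for all } (i,j,k)\in\{1,\dots,n\}^3 \text{ with } i+j+k = 2n+1,$$ $$r_i, c_j, d_k \geq 0 \text{ for all } i,j,k,$$ and the value of the objective function at this solution equals $\mathrm{LP}^*(n)$, where $\mathrm{LP}^*(3t) = 2t + \frac{t}{3t+1}$, $\mathrm{LP}^*(3t+1) = 2t+1$ and $\mathrm{LP}^*(3t+2) = 2t+1+\frac{2t+1}{3t+2}$.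
   Context: This linear program is the dual of the LP relaxation of the problem of placing dots in the cells of a triangle of size $n$ (the cells $(a,b)\in\{1,\dots,n\}^2$ with $a+b\ge n+1$) with at most one dot per row, column and southwest-to-northeast diagonal; the triples $(i,j,k)$ with $i+j+k=2n+1$, $1\le i,j,k\le n$, correspond bijectively to the cells, where $i$, $j$, $k$ are the numbers of cells in the row, column and diagonal through the cell. -}

module Defs where

open import Data.Nat as ℕ using (ℕ; zero; suc; _*_)
open import Data.Integer as ℤ using (ℤ; +_)
open import Data.Rational using (ℚ; 0ℚ; 1ℚ; _/_; _⊔_; _≤_; _+_)
open import Data.Product using (_×_)
open import Relation.Binary.PropositionalEquality using (_≡_)

Σ₁ : ℕ → (ℕ → ℚ) → ℚ
Σ₁ zero    f = 0ℚ
Σ₁ (suc n) f = Σ₁ n f + f (suc n)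

objective : ℕ → (ℕ → ℚ) → (ℕ → ℚ) → (ℕ → ℚ) → ℚ
objective n r c d = Σ₁ n r + Σ₁ n c + Σ₁ n d

Feasible : ℕ → (ℕ → ℚ) → (ℕ → ℚ) → (ℕ → ℚ) → Set
Feasible n r c d =
  (∀ i j k → 1 ℕ.≤ i → i ℕ.≤ n → 1 ℕ.≤ j → j ℕ.≤ n → 1 ℕ.≤ k → k ℕ.≤ n →
     i ℕ.+ j ℕ.+ k ≡ 2 * n ℕ.+ 1 → 1ℚ ≤ r i + c j + d k)
  × (∀ i → 1 ℕ.≤ i → i ℕ.≤ n → (0ℚ ≤ r i) × (0ℚ ≤ c i) × (0ℚ ≤ d i))

-- max{0, (i - s)/(m+1)}
posPart : ℕ → ℕ → (m : ℕ) → ℚ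
posPart i s m = 0ℚ ⊔ ((+ i ℤ.- + s) / suc m)

-- n = 3t+1 :  r_i = c_i = max{0,(i-t-1)/(3t+1)},  d_i = max{0,(i-t)/(3t+1)}
rc₁ d₁ : ℕ → ℕ → ℚ
rc₁ t i = posPart i (suc t) (3 * t)
d₁  t i = posPart i t (3 * t)

-- n = 3t+2 :  r_i = c_i = d_i = max{0,(i-t-1)/(3t+2)}
v₂ : ℕ → ℕ → ℚ
v₂ t i = posPart i (suc t) (suc (3 * t))

-- n = 3t :  r_i = c_i = d_i = max{0,(i-t)/(3t+1)}
v₀ : ℕ → ℕ → ℚ
v₀ t i = posPart i t (3 * t)

LP*₀ LP*₁ LP*₂ : ℕ → ℚ
LP*₀ t = (+ (2 * t) / 1) + (+ t / suc (3 * t))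
LP*₁ t = + (2 * t ℕ.+ 1) / 1
LP*₂ t = (+ (2 * t ℕ.+ 1) / 1) + (+ (2 * t ℕ.+ 1) / suc (suc (3 * t)))

-- Every value in the statement has the form max(0, (i - s)/(m + 1)) = (i ∸ s)/(m + 1),
-- so a sum of them over i ≤ n is the triangular number T(n - s) over m + 1.  For a
-- constraint with i + j + k = 2n + 1 we have (i ∸ a) + (j ∸ b) + (k ∸ c) ≥ 2n + 1 - (a + b + c),
-- and the shifts a, b, c of the three families are chosen with a + b + c = 2n - m, so this
-- is at least m + 1 and the constraint holds.  The three objective values are then identities between triangular numbers.
module Submission where

open import Defs
open import Data.Nat using (ℕ; _*_; _+_; _≤_)
open import Data.Product using (_×_; _,_)
open import Relation.Binary.PropositionalEquality using (_≡_)

open import Data.Nat as ℕ using (zero; suc; _∸_; z≤n)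
import Data.Nat.Properties as ℕ
open import Data.Nat.Tactic.RingSolver using (solve-∀)
open import Data.Integer as ℤ using (+_; +≤+)
import Data.Integer.Properties as ℤ
open import Data.Rational as ℚ using (ℚ; 0ℚ; 1ℚ; fromℚᵘ)
import Data.Rational.Properties as ℚ
open import Data.Rational.Unnormalised as ℚᵘ using (mkℚᵘ; *≡*; *≤*)
import Data.Rational.Unnormalised.Properties as ℚᵘ
open import Data.Sum using (inj₁; inj₂)
open import Relation.Binary.PropositionalEquality using (refl; sym; trans; cong; cong₂; subst₂; module ≡-Reasoning)

fromℚᵘ-homo-+ : ∀ p q → fromℚᵘ (p ℚᵘ.+ q) ≡ fromℚᵘ p ℚ.+ fromℚᵘ q
fromℚᵘ-homo-+ p q = ℚ.toℚᵘ-injective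
  (ℚᵘ.≃-trans (ℚ.toℚᵘ-fromℚᵘ (p ℚᵘ.+ q))
  (ℚᵘ.≃-trans (ℚᵘ.+-cong (ℚᵘ.≃-sym (ℚ.toℚᵘ-fromℚᵘ p)) (ℚᵘ.≃-sym (ℚ.toℚᵘ-fromℚᵘ q)))
              (ℚᵘ.≃-sym (ℚ.toℚᵘ-homo-+ (fromℚᵘ p) (fromℚᵘ q)))))

fromℚᵘ-mono-≤ : ∀ {p q} → p ℚᵘ.≤ q → fromℚᵘ p ℚ.≤ fromℚᵘ q
fromℚᵘ-mono-≤ {p} {q} p≤q = ℚ.toℚᵘ-cancel-≤
  (ℚᵘ.≤-respʳ-≃ (ℚᵘ.≃-sym (ℚ.toℚᵘ-fromℚᵘ q)) (ℚᵘ.≤-respˡ-≃ (ℚᵘ.≃-sym (ℚ.toℚᵘ-fromℚᵘ p)) p≤q))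

mkℚᵘ-+-sameDenominator : ∀ p q m → mkℚᵘ p m ℚᵘ.+ mkℚᵘ q m ℚᵘ.≃ mkℚᵘ (p ℤ.+ q) m
mkℚᵘ-+-sameDenominator p q m = *≡* (begin
  (p ℤ.* + s ℤ.+ q ℤ.* + s) ℤ.* + s ≡⟨ cong (ℤ._* + s) (ℤ.*-distribʳ-+ (+ s) p q) ⟨
  (p ℤ.+ q) ℤ.* + s ℤ.* + s         ≡⟨ ℤ.*-assoc (p ℤ.+ q) (+ s) (+ s) ⟩
  (p ℤ.+ q) ℤ.* (+ s ℤ.* + s)       ≡⟨ cong ((p ℤ.+ q) ℤ.*_) (ℤ.pos-* s s) ⟨
  (p ℤ.+ q) ℤ.* + (s * s)           ∎)
  where
  open ≡-Reasoning
  s = suc m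

-- a / (m + 1), with the same offset-by-one denominator as posPart.  It is opaque so that
-- unification never unfolds the gcd normalisation inside ℚ._/_.
opaque
  frac : ℕ → ℕ → ℚ
  frac a m = + a ℚ./ suc m

opaque
  unfolding frac

  frac-def : ∀ a m → frac a m ≡ + a ℚ./ suc m
  frac-def a m = refl

  frac-cong : ∀ {a m b k} → a * suc k ≡ b * suc m → frac a m ≡ frac b k
  frac-cong {a} {m} {b} {k} eq = ℚ.fromℚᵘ-cong {mkℚᵘ (+ a) m} {mkℚᵘ (+ b) k}
    (*≡* (trans (sym (ℤ.pos-* a (suc k))) (trans (cong +_ eq) (ℤ.pos-* b (suc m)))))

  frac-mono-≤ : ∀ {a m b k} → a * suc k ≤ b * suc m → frac a m ℚ.≤ frac b k
  frac-mono-≤ {a} {m} {b} {k} le = fromℚᵘ-mono-≤ {mkℚᵘ (+ a) m} {mkℚᵘ (+ b) k}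
    (*≤* (subst₂ ℤ._≤_ (ℤ.pos-* a (suc k)) (ℤ.pos-* b (suc m)) (+≤+ le)))

  frac-zero : ∀ m → frac 0 m ≡ 0ℚ
  frac-zero m = ℚ.0/n≡0 (suc m)

  frac-nonNeg : ∀ a m → 0ℚ ℚ.≤ frac a m
  frac-nonNeg a m = subst₂ ℚ._≤_ (frac-zero m) refl (frac-mono-≤ {0} {m} {a} {m} z≤n)

  frac-+ : ∀ a b m → frac a m ℚ.+ frac b m ≡ frac (a + b) m
  frac-+ a b m = begin
    frac a m ℚ.+ frac b m                  ≡⟨ fromℚᵘ-homo-+ (mkℚᵘ (+ a) m) (mkℚᵘ (+ b) m) ⟨
    fromℚᵘ (mkℚᵘ (+ a) m ℚᵘ.+ mkℚᵘ (+ b) m) ≡⟨ ℚ.fromℚᵘ-cong (mkℚᵘ-+-sameDenominator (+ a) (+ b) m) ⟩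
    frac (a + b) m                          ∎
    where open ≡-Reasoning

  posPart≡frac : ∀ i s m → posPart i s m ≡ frac (i ∸ s) m
  posPart≡frac i s m with ℕ.≤-total s i
  ... | inj₁ s≤i = trans (cong (0ℚ ℚ.⊔_) (cong (ℚ._/ suc m) i-s≡i∸s))
                         (ℚ.p≤q⇒p⊔q≡q (frac-nonNeg (i ∸ s) m))
    where
    i-s≡i∸s : + i ℤ.- + s ≡ + (i ∸ s)
    i-s≡i∸s = trans (ℤ.m-n≡m⊖n i s) (ℤ.⊖-≥ s≤i)
  ... | inj₂ i≤s = trans (ℚ.p≥q⇒p⊔q≡p nonPos)
                         (sym (trans (cong (λ a → frac a m) (ℕ.m≤n⇒m∸n≡0 i≤s)) (frac-zero m)))
    where
    nonPos : (+ i ℤ.- + s) ℚ./ suc m ℚ.≤ 0ℚ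
    nonPos = subst₂ ℚ._≤_ refl (frac-zero m) (fromℚᵘ-mono-≤ {mkℚᵘ (+ i ℤ.- + s) m} {mkℚᵘ (+ 0) m}
               (*≤* (ℤ.*-monoʳ-≤-nonNeg (+ suc m) (ℤ.i≤j⇒i-j≤0 (+≤+ i≤s)))))

frac-*-suc : ∀ q m → frac (q * suc m) m ≡ frac q 0
frac-*-suc q m = frac-cong (ℕ.*-identityʳ (q * suc m))

frac-split : ∀ q r m → frac (q * suc m + r) m ≡ frac q 0 ℚ.+ frac r m
frac-split q r m = trans (sym (frac-+ (q * suc m) r m)) (cong (ℚ._+ frac r m) (frac-*-suc q m))

tri : ℕ → ℕ
tri zero    = 0
tri (suc k) = tri k + suc k

tri-double : ∀ k → 2 * tri k ≡ k * suc k
tri-double zero    = refl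
tri-double (suc k) = begin
  2 * (tri k + suc k)      ≡⟨ ℕ.*-distribˡ-+ 2 (tri k) (suc k) ⟩
  2 * tri k + 2 * suc k    ≡⟨ cong (_+ 2 * suc k) (tri-double k) ⟩
  k * suc k + 2 * suc k    ≡⟨ expand k ⟩
  suc k * suc (suc k)      ∎
  where
  open ≡-Reasoning
  expand : ∀ k → k * suc k + 2 * suc k ≡ suc k * suc (suc k)
  expand = solve-∀

tri-∸-suc : ∀ n s → tri (n ∸ s) + (suc n ∸ s) ≡ tri (suc n ∸ s)
tri-∸-suc n       zero    = refl
tri-∸-suc zero    (suc s) rewrite ℕ.0∸n≡0 s = refl
tri-∸-suc (suc n) (suc s) = tri-∸-suc n s

tri-sum : ∀ x y z N → x * suc x + y * suc y + z * suc z ≡ 2 * N → tri x + tri y + tri z ≡ N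
tri-sum x y z N eq = ℕ.*-cancelˡ-≡ _ N 2 (begin
  2 * (tri x + tri y + tri z)         ≡⟨ ℕ.*-distribˡ-+ 2 (tri x + tri y) (tri z) ⟩
  2 * (tri x + tri y) + 2 * tri z     ≡⟨ cong (_+ 2 * tri z) (ℕ.*-distribˡ-+ 2 (tri x) (tri y)) ⟩
  2 * tri x + 2 * tri y + 2 * tri z   ≡⟨ cong₂ _+_ (cong₂ _+_ (tri-double x) (tri-double y)) (tri-double z) ⟩
  x * suc x + y * suc y + z * suc z   ≡⟨ eq ⟩
  2 * N                               ∎)
  where open ≡-Reasoning

Σ₁-posPart : ∀ n s m → Σ₁ n (λ i → posPart i s m) ≡ frac (tri (n ∸ s)) m
Σ₁-posPart zero    s m rewrite ℕ.0∸n≡0 s = sym (frac-zero m)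
Σ₁-posPart (suc n) s m = begin
  Σ₁ n (λ i → posPart i s m) ℚ.+ posPart (suc n) s m   ≡⟨ cong₂ ℚ._+_ (Σ₁-posPart n s m) (posPart≡frac (suc n) s m) ⟩
  frac (tri (n ∸ s)) m ℚ.+ frac (suc n ∸ s) m          ≡⟨ frac-+ (tri (n ∸ s)) (suc n ∸ s) m ⟩
  frac (tri (n ∸ s) + (suc n ∸ s)) m                   ≡⟨ cong (λ a → frac a m) (tri-∸-suc n s) ⟩
  frac (tri (suc n ∸ s)) m                             ∎
  where open ≡-Reasoning

posPart-nonNeg : ∀ i s m → 0ℚ ℚ.≤ posPart i s m
posPart-nonNeg i s m = ℚ.p≤p⊔q 0ℚ ((+ i ℤ.- + s) ℚ./ suc m)

excess≤∸-sum : ∀ i j k a b c M → i + j + k ≡ M + (a + b + c) → M ≤ (i ∸ a) + (j ∸ b) + (k ∸ c)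
excess≤∸-sum i j k a b c M eq = ℕ.+-cancelʳ-≤ (a + b + c) M _ (begin
  M + (a + b + c)                                   ≡⟨ eq ⟨
  i + j + k                                         ≤⟨ ℕ.+-mono-≤ (ℕ.+-mono-≤ (ℕ.m≤n+m∸n i a) (ℕ.m≤n+m∸n j b)) (ℕ.m≤n+m∸n k c) ⟩
  a + (i ∸ a) + (b + (j ∸ b)) + (c + (k ∸ c))       ≡⟨ regroup a (i ∸ a) b (j ∸ b) c (k ∸ c) ⟩
  (i ∸ a) + (j ∸ b) + (k ∸ c) + (a + b + c)         ∎)
  where
  open ℕ.≤-Reasoning
  regroup : ∀ a x b y c z → a + x + (b + y) + (c + z) ≡ x + y + z + (a + b + c)
  regroup = solve-∀

posPart-sum≥1 : ∀ i j k a b c m → i + j + k ≡ suc m + (a + b + c) →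
                1ℚ ℚ.≤ posPart i a m ℚ.+ posPart j b m ℚ.+ posPart k c m
posPart-sum≥1 i j k a b c m eq = begin
  1ℚ                                                   ≡⟨ frac-def 1 0 ⟨
  frac 1 0                                             ≤⟨ frac-mono-≤ m+1≤S*1 ⟩
  frac S m                                             ≡⟨ frac-+ (i ∸ a + (j ∸ b)) (k ∸ c) m ⟨
  frac (i ∸ a + (j ∸ b)) m ℚ.+ frac (k ∸ c) m          ≡⟨ cong (ℚ._+ frac (k ∸ c) m) (frac-+ (i ∸ a) (j ∸ b) m) ⟨
  frac (i ∸ a) m ℚ.+ frac (j ∸ b) m ℚ.+ frac (k ∸ c) m ≡⟨ cong₂ ℚ._+_ (cong₂ ℚ._+_ (posPart≡frac i a m) (posPart≡frac j b m)) (posPart≡frac k c m) ⟨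
  posPart i a m ℚ.+ posPart j b m ℚ.+ posPart k c m    ∎
  where
  open ℚ.≤-Reasoning
  S = (i ∸ a) + (j ∸ b) + (k ∸ c)
  m+1≤S*1 : 1 * suc m ≤ S * 1
  m+1≤S*1 = subst₂ _≤_ (sym (ℕ.*-identityˡ (suc m))) (sym (ℕ.*-identityʳ S)) (excess≤∸-sum i j k a b c (suc m) eq)

posPart-feasible : ∀ n a b c m → 2 * n + 1 ≡ suc m + (a + b + c) →
                   Feasible n (λ i → posPart i a m) (λ j → posPart j b m) (λ k → posPart k c m)
posPart-feasible n a b c m total =
  (λ i j k _ _ _ _ _ _ ijk → posPart-sum≥1 i j k a b c m (trans ijk total)) ,
  (λ i _ _ → posPart-nonNeg i a m , posPart-nonNeg i b m , posPart-nonNeg i c m)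

objective-posPart : ∀ n a b c m {ka kb kc} → n ≡ a + ka → n ≡ b + kb → n ≡ c + kc →
                    objective n (λ i → posPart i a m) (λ j → posPart j b m) (λ k → posPart k c m)
                      ≡ frac (tri ka + tri kb + tri kc) m
objective-posPart n a b c m {ka} {kb} {kc} na nb nc = begin
  objective n (λ i → posPart i a m) (λ j → posPart j b m) (λ k → posPart k c m)
    ≡⟨ cong₂ ℚ._+_ (cong₂ ℚ._+_ (Σ₁-posPart n a m) (Σ₁-posPart n b m)) (Σ₁-posPart n c m) ⟩
  frac (tri (n ∸ a)) m ℚ.+ frac (tri (n ∸ b)) m ℚ.+ frac (tri (n ∸ c)) m
    ≡⟨ cong₂ ℚ._+_ (cong₂ ℚ._+_ (fracTri a ka na) (fracTri b kb nb)) (fracTri c kc nc) ⟩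
  frac (tri ka) m ℚ.+ frac (tri kb) m ℚ.+ frac (tri kc) m
    ≡⟨ cong (ℚ._+ frac (tri kc) m) (frac-+ (tri ka) (tri kb) m) ⟩
  frac (tri ka + tri kb) m ℚ.+ frac (tri kc) m
    ≡⟨ frac-+ (tri ka + tri kb) (tri kc) m ⟩
  frac (tri ka + tri kb + tri kc) m ∎
  where
  open ≡-Reasoning
  fracTri : ∀ s k → n ≡ s + k → frac (tri (n ∸ s)) m ≡ frac (tri k) m
  fracTri s k refl = cong (λ x → frac (tri x) m) (ℕ.m+n∸m≡n s k)

rc₁-d₁-solution : ∀ t → Feasible (3 * t + 1) (rc₁ t) (rc₁ t) (d₁ t)
                      × objective (3 * t + 1) (rc₁ t) (rc₁ t) (d₁ t) ≡ LP*₁ t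
rc₁-d₁-solution t =
  posPart-feasible (3 * t + 1) (suc t) (suc t) t (3 * t) (shifts t) ,
  (begin
    objective (3 * t + 1) (rc₁ t) (rc₁ t) (d₁ t)       ≡⟨ objective-posPart (3 * t + 1) (suc t) (suc t) t (3 * t) (n-split t) (n-split t) (n-split′ t) ⟩
    frac (tri (2 * t) + tri (2 * t) + tri (suc (2 * t))) (3 * t)
                                                        ≡⟨ cong (λ x → frac x (3 * t)) (tri-sum (2 * t) (2 * t) (suc (2 * t)) _ (doubled t)) ⟩
    frac ((2 * t + 1) * suc (3 * t)) (3 * t)            ≡⟨ frac-*-suc (2 * t + 1) (3 * t) ⟩
    frac (2 * t + 1) 0                                  ≡⟨ frac-def (2 * t + 1) 0 ⟩
    LP*₁ t                                              ∎)
  where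
  open ≡-Reasoning
  shifts : ∀ t → 2 * (3 * t + 1) + 1 ≡ suc (3 * t) + (suc t + suc t + t)
  shifts = solve-∀
  n-split : ∀ t → 3 * t + 1 ≡ suc t + 2 * t
  n-split = solve-∀
  n-split′ : ∀ t → 3 * t + 1 ≡ t + suc (2 * t)
  n-split′ = solve-∀
  doubled : ∀ t → 2 * t * suc (2 * t) + 2 * t * suc (2 * t) + suc (2 * t) * suc (suc (2 * t))
              ≡ 2 * ((2 * t + 1) * suc (3 * t))
  doubled = solve-∀

v₂-solution : ∀ t → Feasible (3 * t + 2) (v₂ t) (v₂ t) (v₂ t)
                  × objective (3 * t + 2) (v₂ t) (v₂ t) (v₂ t) ≡ LP*₂ t
v₂-solution t =
  posPart-feasible (3 * t + 2) (suc t) (suc t) (suc t) (suc (3 * t)) (shifts t) ,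
  (begin
    objective (3 * t + 2) (v₂ t) (v₂ t) (v₂ t)         ≡⟨ objective-posPart (3 * t + 2) (suc t) (suc t) (suc t) (suc (3 * t)) (n-split t) (n-split t) (n-split t) ⟩
    frac (tri k + tri k + tri k) (suc (3 * t))          ≡⟨ cong (λ x → frac x (suc (3 * t))) (tri-sum k k k _ (doubled t)) ⟩
    frac ((2 * t + 1) * suc (suc (3 * t)) + (2 * t + 1)) (suc (3 * t))
                                                        ≡⟨ frac-split (2 * t + 1) (2 * t + 1) (suc (3 * t)) ⟩
    frac (2 * t + 1) 0 ℚ.+ frac (2 * t + 1) (suc (3 * t))
                                                        ≡⟨ cong₂ ℚ._+_ (frac-def (2 * t + 1) 0) (frac-def (2 * t + 1) (suc (3 * t))) ⟩
    LP*₂ t                                              ∎)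
  where
  open ≡-Reasoning
  k = suc (2 * t)
  shifts : ∀ t → 2 * (3 * t + 2) + 1 ≡ suc (suc (3 * t)) + (suc t + suc t + suc t)
  shifts = solve-∀
  n-split : ∀ t → 3 * t + 2 ≡ suc t + suc (2 * t)
  n-split = solve-∀
  doubled : ∀ t → suc (2 * t) * suc (suc (2 * t)) + suc (2 * t) * suc (suc (2 * t)) + suc (2 * t) * suc (suc (2 * t))
              ≡ 2 * ((2 * t + 1) * suc (suc (3 * t)) + (2 * t + 1))
  doubled = solve-∀

v₀-solution : ∀ t → Feasible (3 * t) (v₀ t) (v₀ t) (v₀ t)
                  × objective (3 * t) (v₀ t) (v₀ t) (v₀ t) ≡ LP*₀ t
v₀-solution t =
  posPart-feasible (3 * t) t t t (3 * t) (shifts t) ,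
  (begin
    objective (3 * t) (v₀ t) (v₀ t) (v₀ t)              ≡⟨ objective-posPart (3 * t) t t t (3 * t) (n-split t) (n-split t) (n-split t) ⟩
    frac (tri (2 * t) + tri (2 * t) + tri (2 * t)) (3 * t)
                                                        ≡⟨ cong (λ x → frac x (3 * t)) (tri-sum (2 * t) (2 * t) (2 * t) _ (doubled t)) ⟩
    frac (2 * t * suc (3 * t) + t) (3 * t)              ≡⟨ frac-split (2 * t) t (3 * t) ⟩
    frac (2 * t) 0 ℚ.+ frac t (3 * t)                   ≡⟨ cong₂ ℚ._+_ (frac-def (2 * t) 0) (frac-def t (3 * t)) ⟩
    LP*₀ t                                              ∎)
  where
  open ≡-Reasoning
  shifts : ∀ t → 2 * (3 * t) + 1 ≡ suc (3 * t) + (t + t + t)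
  shifts = solve-∀
  n-split : ∀ t → 3 * t ≡ t + 2 * t
  n-split = solve-∀
  doubled : ∀ t → 2 * t * suc (2 * t) + 2 * t * suc (2 * t) + 2 * t * suc (2 * t) ≡ 2 * (2 * t * suc (3 * t) + t)
  doubled = solve-∀

-- The case n = 3t also holds for t = 0 (the empty program).
lemma2 : (∀ (t : ℕ) → Feasible (3 * t + 1) (rc₁ t) (rc₁ t) (d₁ t)
                      × objective (3 * t + 1) (rc₁ t) (rc₁ t) (d₁ t) ≡ LP*₁ t)
         × (∀ (t : ℕ) → Feasible (3 * t + 2) (v₂ t) (v₂ t) (v₂ t)
                      × objective (3 * t + 2) (v₂ t) (v₂ t) (v₂ t) ≡ LP*₂ t)
         × (∀ (t : ℕ) → 1 ≤ t → Feasible (3 * t) (v₀ t) (v₀ t) (v₀ t)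
                      × objective (3 * t) (v₀ t) (v₀ t) (v₀ t) ≡ LP*₀ t)
lemma2 = rc₁-d₁-solution , v₂-solution , λ t _ → v₀-solution t
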